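{- Let $t$ be a $\lambda$-term. All $\mathsf{shuf}$-normalizing derivations from $t$ (if any) have the same number of $\beta_v$-steps.
   Context: $\lambda$-terms: $t,u,s::= v\mid tu$, values $v::= x\mid \lambda x.t$, up to $\alpha$; $t\{x\leftarrow u\}$ capture-avoiding substitution. Shuffling calculus: balanced contexts $B::=\langle\cdot\rangle\mid tB\mid Bt\mid (\lambda x.B)t$; $\to_{\mathsf{shuf}}$ is the closure under balanced contexts of the $\sigma$-rules $((\lambda x.t)u)s\mapsto(\lambda x.ts)u$ ($x\notin\mathrm{fv}(s)$) and $v((\lambda x.s)u)\mapsto(\lambda x.vs)u$ ($v$ value, $x\notin\mathrm{fv}(v)$), and of the $\beta_v$-rule $(\lambda x.t)v\mapsto t\{x\leftarrow v\}$ ($v$ a value). A $\mathsf{shuf}$-normalizing derivation is a finite $\to_{\mathsf{shuf}}$-derivation ending in a term with no $\to_{\mathsf{shuf}}$-step. -}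

module Defs where

open import Data.Nat using (ℕ; zero; suc; _+_; _<ᵇ_)
open import Data.Bool using (if_then_else_)
open import Data.Product using (∃)
open import Relation.Nullary using (¬_)

-- λ-terms up to α-equivalence: de Bruijn indices (open terms allowed).
data Term : Set where
  var : ℕ → Term
  lam : Term → Term
  app : Term → Term → Term

data IsValue : Term → Set where
  v-var : ∀ {x} → IsValue (var x)
  v-lam : ∀ {t} → IsValue (lam t)

shift : ℕ → Term → Term
shift c (var x) = if x <ᵇ c then var x else var (suc x)
shift c (lam t) = lam (shift (suc c) t)
shift c (app t u) = app (shift c t) (shift c u)

-- sub j s t : replace index j of t by s (s lives in the context outside
-- the j binders), removing that binder (indices above j are decremented).
subVar : ℕ → Term → ℕ → Term
subVar zero    s zero    = s
subVar zero    s (suc x) = var x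
subVar (suc j) s zero    = var zero
subVar (suc j) s (suc x) = shift 0 (subVar j s x)

sub : ℕ → Term → Term → Term
sub j s (var x)   = subVar j s x
sub j s (lam t)   = lam (sub (suc j) s t)
sub j s (app t u) = app (sub j s t) (sub j s u)

data Kind : Set where
  βv σ : Kind

βcount : Kind → ℕ
βcount βv = 1
βcount σ  = 0

-- shuffling step: closure under balanced contexts
--   B ::= ⟨·⟩ | t B | B t | (λx.B) t
-- of the rules σ₁, σ₃ (labelled σ) and βv.
-- The side conditions x ∉ fv(s), x ∉ fv(v) are automatic with de Bruijn
-- indices: s (resp. v) is moved under the binder and hence shifted.
data _⟶[_]_ : Term → Kind → Term → Set where
  rule-βv : ∀ {t v} → IsValue v → app (lam t) v ⟶[ βv ] sub 0 v t
  rule-σ₁ : ∀ {t u s} →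
    app (app (lam t) u) s ⟶[ σ ] app (lam (app t (shift 0 s))) u
  rule-σ₃ : ∀ {v s u} → IsValue v →
    app v (app (lam s) u) ⟶[ σ ] app (lam (app (shift 0 v) s)) u
  ctx-appR : ∀ {k t u u'} → u ⟶[ k ] u' → app t u ⟶[ k ] app t u'
  ctx-appL : ∀ {k t t' u} → t ⟶[ k ] t' → app t u ⟶[ k ] app t' u
  ctx-lam  : ∀ {k t t' u} → t ⟶[ k ] t' → app (lam t) u ⟶[ k ] app (lam t') u

data _⟶*[_]_ : Term → ℕ → Term → Set where
  done : ∀ {t} → t ⟶*[ 0 ] t
  step : ∀ {t t' u k n} → t ⟶[ k ] t' → t' ⟶*[ n ] u →
         t ⟶*[ βcount k + n ] u

Normal : Term → Set
Normal t = ¬ (∃ λ k → ∃ λ t' → t ⟶[ k ] t')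

module Submission where

-- The argument is a quantitative Newman's lemma.  The shuffling calculus is
-- locally confluent in a β-counting sense: two one-step reducts of a term
-- have a common reduct such that both paths through it contain the same
-- number of βv-steps (`local-confluence`).  σ-steps alone terminate, as the
-- polynomial interpretation Φ strictly decreases along them (`Φ-decreases`).
-- From these two facts, by well-founded induction on the lexicographic
-- order `_⊏_` on pairs (number of βv-steps of a normalizing derivation, Φ),
-- we obtain `preservation`: if t normalizes with n βv-steps and t ⟶[ k ] s,
-- then s normalizes with n - βcount k βv-steps.  The theorem follows by
-- induction on one of the two derivations.

open import Defs
open import Data.Nat using (ℕ)
open import Relation.Binary.PropositionalEquality using (_≡_)

open import Data.Nat using (zero; suc; _+_; _*_; _≤_; _<_; z≤n; s≤s; _<ᵇ_)
open import Data.Nat.Properties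
  using (+-assoc; +-comm; m≤m+n; n<1+n; <-trans;
         *-monoʳ-<; *-monoˡ-<; +-monoˡ-<)
open import Data.Nat.Tactic.RingSolver using (solve-∀)
open import Data.Bool using (true; false)
open import Data.Product using (∃; _×_; _,_)
open import Data.Sum using (inj₁; inj₂)
open import Data.Empty using (⊥; ⊥-elim)
open import Level using (0ℓ)
open import Function using (_on_)
open import Relation.Binary.Core using (Rel)
open import Relation.Binary.Definitions using (Transitive)
open import Relation.Binary.PropositionalEquality
  using (refl; sym; trans; cong; cong₂; module ≡-Reasoning)
open import Relation.Binary.Construct.On as On using ()
open import Data.Product.Relation.Binary.Lex.Strict using (×-Lex; ×-wellFounded)
open import Data.Nat.Induction using (<-wellFounded)
open import Induction.WellFounded using (WellFounded; WfRec; module All; module Subrelation)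

shiftIndex : ℕ → ℕ → ℕ
shiftIndex zero    x       = suc x
shiftIndex (suc c) zero    = zero
shiftIndex (suc c) (suc x) = suc (shiftIndex c x)

-- Increments a variable (and is the identity elsewhere); used only to
-- transport the recursive description of `shiftIndex` through `shift`.
incVar : Term → Term
incVar (var y) = var (suc y)
incVar t       = t

shift-var : ∀ c x → shift c (var x) ≡ var (shiftIndex c x)
shift-var zero    x       = refl
shift-var (suc c) zero    = refl
shift-var (suc c) (suc x) with x <ᵇ c | shift-var c x
... | true  | e = cong incVar e
... | false | e = cong incVar e

shiftIndex-comm : ∀ c d x → c ≤ d →
  shiftIndex (suc d) (shiftIndex c x) ≡ shiftIndex c (shiftIndex d x)
shiftIndex-comm zero    d       x       _         = refl
shiftIndex-comm (suc c) (suc d) zero    _         = refl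
shiftIndex-comm (suc c) (suc d) (suc x) (s≤s c≤d) = cong suc (shiftIndex-comm c d x c≤d)

shift-comm : ∀ c d t → c ≤ d → shift (suc d) (shift c t) ≡ shift c (shift d t)
shift-comm c d (var x) c≤d
  rewrite shift-var c x | shift-var (suc d) (shiftIndex c x)
        | shift-var d x | shift-var c (shiftIndex d x)
  = cong var (shiftIndex-comm c d x c≤d)
shift-comm c d (lam t)   c≤d = cong lam (shift-comm (suc c) (suc d) t (s≤s c≤d))
shift-comm c d (app t u) c≤d = cong₂ app (shift-comm c d t c≤d) (shift-comm c d u c≤d)

sub-shift-cancel : ∀ c w t → sub c w (shift c t) ≡ t
sub-shift-cancel c w (var x) rewrite shift-var c x = subVar-cancel c x
  where
  subVar-cancel : ∀ c x → subVar c w (shiftIndex c x) ≡ var x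
  subVar-cancel zero    x       = refl
  subVar-cancel (suc c) zero    = refl
  subVar-cancel (suc c) (suc x) = cong (shift 0) (subVar-cancel c x)
sub-shift-cancel c w (lam t)   = cong lam (sub-shift-cancel (suc c) w t)
sub-shift-cancel c w (app t u) = cong₂ app (sub-shift-cancel c w t) (sub-shift-cancel c w u)

sub-shift-comm : ∀ v c j t → c ≤ j → sub (suc j) v (shift c t) ≡ shift c (sub j v t)
sub-shift-comm v c j (var x) c≤j rewrite shift-var c x = subVar-shift c j x c≤j
  where
  subVar-shift : ∀ c j x → c ≤ j → subVar (suc j) v (shiftIndex c x) ≡ shift c (subVar j v x)
  subVar-shift zero    j       x       _         = refl
  subVar-shift (suc c) (suc j) zero    _         = refl
  subVar-shift (suc c) (suc j) (suc x) (s≤s c≤j) =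
    trans (cong (shift 0) (subVar-shift c j x c≤j)) (sym (shift-comm 0 c (subVar j v x) z≤n))
sub-shift-comm v c j (lam t)   c≤j = cong lam (sub-shift-comm v (suc c) (suc j) t (s≤s c≤j))
sub-shift-comm v c j (app t u) c≤j = cong₂ app (sub-shift-comm v c j t c≤j) (sub-shift-comm v c j u c≤j)

sub-sub : ∀ v w i j t → sub (i + j) v (sub i w t) ≡ sub i (sub j v w) (sub (suc (i + j)) v t)
sub-sub v w i j (var x) = subVar-sub i x
  where
  subVar-sub : ∀ i x → sub (i + j) v (subVar i w x) ≡ sub i (sub j v w) (subVar (suc (i + j)) v x)
  subVar-sub zero    zero    = refl
  subVar-sub zero    (suc x) = sym (sub-shift-cancel 0 (sub j v w) (subVar j v x))
  subVar-sub (suc i) zero    = refl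
  subVar-sub (suc i) (suc x) = begin
      sub (suc (i + j)) v (shift 0 (subVar i w x))
    ≡⟨ sub-shift-comm v 0 (i + j) (subVar i w x) z≤n ⟩
      shift 0 (sub (i + j) v (subVar i w x))
    ≡⟨ cong (shift 0) (subVar-sub i x) ⟩
      shift 0 (sub i (sub j v w) (subVar (suc (i + j)) v x))
    ≡⟨ sym (sub-shift-comm (sub j v w) 0 i (subVar (suc (i + j)) v x) z≤n) ⟩
      sub (suc i) (sub j v w) (shift 0 (subVar (suc (i + j)) v x))
    ∎
    where open ≡-Reasoning
sub-sub v w i j (lam t)   = cong lam (sub-sub v w (suc i) j t)
sub-sub v w i j (app t u) = cong₂ app (sub-sub v w i j t) (sub-sub v w i j u)

shift-sub : ∀ v j c t → shift (j + c) (sub j v t) ≡ sub j (shift c v) (shift (suc (j + c)) t)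
shift-sub v j c (var x) rewrite shift-var (suc (j + c)) x = shift-subVar j x
  where
  shift-subVar : ∀ j x → shift (j + c) (subVar j v x) ≡ subVar j (shift c v) (shiftIndex (suc (j + c)) x)
  shift-subVar zero    zero    = refl
  shift-subVar zero    (suc x) = shift-var c x
  shift-subVar (suc j) zero    = refl
  shift-subVar (suc j) (suc x) =
    trans (shift-comm 0 (j + c) (subVar j v x) z≤n) (cong (shift 0) (shift-subVar j x))
shift-sub v j c (lam t)   = cong lam (shift-sub v (suc j) c t)
shift-sub v j c (app t u) = cong₂ app (shift-sub v j c t) (shift-sub v j c u)

shift-value : ∀ {v} c → IsValue v → IsValue (shift c v)
shift-value {var x} c v-var rewrite shift-var c x = v-var
shift-value         c v-lam = v-lam

sub-value : ∀ {v w} j → IsValue v → IsValue w → IsValue (sub j v w)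
sub-value {w = var x} j iv v-var = subVar-value j x
  where
  subVar-value : ∀ j x → IsValue (subVar j _ x)
  subVar-value zero    zero    = iv
  subVar-value zero    (suc x) = v-var
  subVar-value (suc j) zero    = v-var
  subVar-value (suc j) (suc x) = shift-value 0 (subVar-value j x)
sub-value j iv v-lam = v-lam

-- Values are shuf-normal: every redex and every balanced context is an
-- application.
value-irreducible : ∀ {v k v'} → IsValue v → v ⟶[ k ] v' → ⊥
value-irreducible v-var ()
value-irreducible v-lam ()

-- Steps are stable under shifting: the rules' side conditions are
-- invariant under renaming.
shift-step : ∀ {t t' k} c → t ⟶[ k ] t' → shift c t ⟶[ k ] shift c t'
shift-step {app (lam t) v} c (rule-βv iv)
  rewrite shift-sub v 0 c t = rule-βv (shift-value c iv)
shift-step {app (app (lam t) u) s} c rule-σ₁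
  rewrite shift-comm 0 c s z≤n = rule-σ₁
shift-step {app v (app (lam s) u)} c (rule-σ₃ iv)
  rewrite shift-comm 0 c v z≤n = rule-σ₃ (shift-value c iv)
shift-step c (ctx-appR p) = ctx-appR (shift-step c p)
shift-step c (ctx-appL p) = ctx-appL (shift-step c p)
shift-step c (ctx-lam p)  = ctx-lam (shift-step (suc c) p)

-- Steps are stable under substitution of a value; the substituend must be a
-- value so that βv- and σ₃-redexes whose argument is a variable survive.
sub-step : ∀ {t t' k v} j → IsValue v → t ⟶[ k ] t' → sub j v t ⟶[ k ] sub j v t'
sub-step {app (lam t) w} {v = v} j iv (rule-βv iw)
  rewrite sub-sub v w 0 j t = rule-βv (sub-value j iv iw)
sub-step {app (app (lam t) u) s} {v = v} j iv rule-σ₁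
  rewrite sub-shift-comm v 0 j s z≤n = rule-σ₁
sub-step {app w (app (lam s) u)} {v = v} j iv (rule-σ₃ iw)
  rewrite sub-shift-comm v 0 j w z≤n = rule-σ₃ (sub-value j iv iw)
sub-step j iv (ctx-appR p) = ctx-appR (sub-step j iv p)
sub-step j iv (ctx-appL p) = ctx-appL (sub-step j iv p)
sub-step j iv (ctx-lam p)  = ctx-lam (sub-step (suc j) iv p)

_++_ : ∀ {a b c m n} → a ⟶*[ m ] b → b ⟶*[ n ] c → a ⟶*[ m + n ] c
done ++ e = e
_++_ {n = n} (step {k = k} {n = n'} p d) e
  rewrite +-assoc (βcount k) n' n = step p (d ++ e)

one : ∀ {t u k} → t ⟶[ k ] u → t ⟶*[ βcount k + 0 ] u
one p = step p done

map* : ∀ {f : Term → Term} → (∀ {k a b} → a ⟶[ k ] b → f a ⟶[ k ] f b) →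
       ∀ {t u n} → t ⟶*[ n ] u → f t ⟶*[ n ] f u
map* F done       = done
map* F (step p d) = step (F p) (map* F d)

step-≡ : ∀ {t s s' k} → t ⟶[ k ] s → s ≡ s' → t ⟶[ k ] s'
step-≡ p refl = p

Joinable : Term → Kind → Term → Kind → Set
Joinable t₁ k₁ t₂ k₂ = ∃ λ q → ∃ λ c₁ → ∃ λ c₂ →
  t₁ ⟶*[ c₁ ] q × t₂ ⟶*[ c₂ ] q × βcount k₁ + c₁ ≡ βcount k₂ + c₂

joinable-refl : ∀ {t k} → Joinable t k t k
joinable-refl = _ , 0 , 0 , done , done , refl

joinable-sym : ∀ {t₁ k₁ t₂ k₂} → Joinable t₁ k₁ t₂ k₂ → Joinable t₂ k₂ t₁ k₁
joinable-sym (q , c₁ , c₂ , d₁ , d₂ , e) = q , c₂ , c₁ , d₂ , d₁ , sym e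

diamond : ∀ {t₁ k₁ t₂ k₂ q} → t₁ ⟶[ k₂ ] q → t₂ ⟶[ k₁ ] q → Joinable t₁ k₁ t₂ k₂
diamond {k₁ = k₁} {k₂ = k₂} p r = _ , _ , _ , one p , one r , balanced k₁ k₂
  where
  balanced : ∀ k₁ k₂ → βcount k₁ + (βcount k₂ + 0) ≡ βcount k₂ + (βcount k₁ + 0)
  balanced βv βv = refl
  balanced βv σ  = refl
  balanced σ  βv = refl
  balanced σ  σ  = refl

joinable-map : ∀ {f : Term → Term} → (∀ {k a b} → a ⟶[ k ] b → f a ⟶[ k ] f b) →
  ∀ {t₁ k₁ t₂ k₂} → Joinable t₁ k₁ t₂ k₂ → Joinable (f t₁) k₁ (f t₂) k₂
joinable-map F (q , c₁ , c₂ , d₁ , d₂ , e) = _ , c₁ , c₂ , map* F d₁ , map* F d₂ , e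

-- Peaks whose left step is a βv-root step: the only overlap is trivial, and
-- a step inside the body commutes with the substitution.
βv-peak : ∀ {t v k r} → IsValue v → app (lam t) v ⟶[ k ] r → Joinable (sub 0 v t) βv r k
βv-peak iv (rule-βv _)   = joinable-refl
βv-peak iv (ctx-appR q)  = ⊥-elim (value-irreducible iv q)
βv-peak iv (ctx-appL ())
βv-peak iv (ctx-lam q)   = diamond (sub-step 0 iv q) (rule-βv iv)

σ₁-peak : ∀ {t u s k r} → app (app (lam t) u) s ⟶[ k ] r →
          Joinable (app (lam (app t (shift 0 s))) u) σ r k
σ₁-peak rule-σ₁                = joinable-refl
σ₁-peak (rule-σ₃ ())
σ₁-peak (ctx-appR q)           = diamond (ctx-lam (ctx-appR (shift-step 0 q))) rule-σ₁
σ₁-peak {t} {u} {s} (ctx-appL (rule-βv iu)) = _ , 1 , 0 , one βv-after , done , refl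
  where
  βv-after : app (lam (app t (shift 0 s))) u ⟶[ βv ] app (sub 0 u t) s
  βv-after = step-≡ (rule-βv iu) (cong (app (sub 0 u t)) (sub-shift-cancel 0 u s))
σ₁-peak {t} {_} {s} (ctx-appL (rule-σ₃ {s = s'} {u = u'} v-lam)) =
  _ , 0 , 0 , one (rule-σ₃ v-lam) , step rule-σ₁ (one σ₁-under-λ) , refl
  where
  -- from ((λx.t)((λy.s')u'))s, shuffling the inner redex first takes two
  -- σ₁-steps to reach the common reduct (λy.(λx.ts)s')u'
  σ₁-under-λ : app (lam (app (app (lam (shift 1 t)) s') (shift 0 s))) u'
               ⟶[ σ ] app (lam (app (lam (app (shift 1 t) (shift 1 (shift 0 s)))) s')) u'
  σ₁-under-λ = step-≡ (ctx-lam rule-σ₁)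
    (cong (λ z → app (lam (app (lam (app (shift 1 t) z)) s')) u') (sym (shift-comm 0 0 s z≤n)))
σ₁-peak (ctx-appL (ctx-appR q)) = diamond (ctx-appR q) rule-σ₁
σ₁-peak (ctx-appL (ctx-appL ()))
σ₁-peak (ctx-appL (ctx-lam q))  = diamond (ctx-lam (ctx-appL q)) rule-σ₁

σ₃-peak : ∀ {v s u k r} → IsValue v → app v (app (lam s) u) ⟶[ k ] r →
          Joinable (app (lam (app (shift 0 v) s)) u) σ r k
σ₃-peak iv    (rule-βv ())
σ₃-peak ()    rule-σ₁
σ₃-peak iv    (rule-σ₃ _)             = joinable-refl
σ₃-peak iv    (ctx-appL q)            = ⊥-elim (value-irreducible iv q)
σ₃-peak v-lam (ctx-lam q)             = diamond (ctx-lam (ctx-lam (shift-step 1 q))) (rule-σ₃ v-lam)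
σ₃-peak {v} {s} {u} iv (ctx-appR (rule-βv iu)) = _ , 1 , 0 , one βv-after , done , refl
  where
  βv-after : app (lam (app (shift 0 v) s)) u ⟶[ βv ] app v (sub 0 u s)
  βv-after = step-≡ (rule-βv iu) (cong (λ z → app z (sub 0 u s)) (sub-shift-cancel 0 u v))
σ₃-peak {v} {s} iv (ctx-appR (rule-σ₃ {s = s'} {u = u'} v-lam)) =
  _ , 0 , 0 , one (rule-σ₃ v-lam) , step (rule-σ₃ iv) (one σ₃-under-λ) , refl
  where
  -- from v((λx.s)((λy.s')u')), shuffling the inner redex first takes two
  -- σ₃-steps to reach the common reduct (λy.(λx.vs)s')u'
  σ₃-under-λ : app (lam (app (shift 0 v) (app (lam (shift 1 s)) s'))) u'
               ⟶[ σ ] app (lam (app (lam (app (shift 1 (shift 0 v)) (shift 1 s))) s')) u'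
  σ₃-under-λ = step-≡ (ctx-lam (rule-σ₃ (shift-value 0 iv)))
    (cong (λ z → app (lam (app (lam (app z (shift 1 s))) s')) u') (sym (shift-comm 0 0 v z≤n)))
σ₃-peak iv (ctx-appR (ctx-appR q))  = diamond (ctx-appR q) (rule-σ₃ iv)
σ₃-peak iv (ctx-appR (ctx-appL ()))
σ₃-peak iv (ctx-appR (ctx-lam q))   = diamond (ctx-lam (ctx-appR q)) (rule-σ₃ iv)

-- Every peak is joinable with balanced βv-counts: root peaks are handled
-- above, steps in disjoint positions commute, and steps in the same
-- position are joined by induction.
local-confluence : ∀ {t k₁ t₁ k₂ t₂} → t ⟶[ k₁ ] t₁ → t ⟶[ k₂ ] t₂ → Joinable t₁ k₁ t₂ k₂
local-confluence (rule-βv iv) q = βv-peak iv q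
local-confluence rule-σ₁      q = σ₁-peak q
local-confluence (rule-σ₃ iv) q = σ₃-peak iv q
local-confluence p (rule-βv iv) = joinable-sym (βv-peak iv p)
local-confluence p rule-σ₁      = joinable-sym (σ₁-peak p)
local-confluence p (rule-σ₃ iv) = joinable-sym (σ₃-peak iv p)
local-confluence (ctx-appR p) (ctx-appR q) = joinable-map ctx-appR (local-confluence p q)
local-confluence (ctx-appR p) (ctx-appL q) = diamond (ctx-appL q) (ctx-appR p)
local-confluence (ctx-appR p) (ctx-lam q)  = diamond (ctx-lam q) (ctx-appR p)
local-confluence (ctx-appL p) (ctx-appR q) = diamond (ctx-appR q) (ctx-appL p)
local-confluence (ctx-appL p) (ctx-appL q) = joinable-map ctx-appL (local-confluence p q)
local-confluence (ctx-appL ()) (ctx-lam q)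
local-confluence (ctx-lam p) (ctx-appR q)  = diamond (ctx-appR q) (ctx-lam p)
local-confluence (ctx-lam p) (ctx-appL ())
local-confluence (ctx-lam p) (ctx-lam q)   = joinable-map ctx-lam (local-confluence p q)

Φ : Term → ℕ
Φ (var x)   = 2
Φ (lam t)   = Φ t + 2
Φ (app t u) = Φ t * Φ u

Φ-shift : ∀ c t → Φ (shift c t) ≡ Φ t
Φ-shift c (var x) rewrite shift-var c x = refl
Φ-shift c (lam t)   = cong (_+ 2) (Φ-shift (suc c) t)
Φ-shift c (app t u) = cong₂ _*_ (Φ-shift c t) (Φ-shift c u)

Φ-≥2 : ∀ t → ∃ λ a → Φ t ≡ 2 + a
Φ-≥2 (var x) = 0 , refl
Φ-≥2 (lam t) = Φ t , +-comm (Φ t) 2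
Φ-≥2 (app t u) with Φ-≥2 t | Φ-≥2 u
... | a , ea | b , eb rewrite ea | eb = _ , refl

<-of-excess : ∀ {m n} r → n ≡ suc (m + r) → m < n
<-of-excess {m} r refl = s≤s (m≤m+n m r)

σ₁-decreases : ∀ a b c → (a * (2 + c) + 2) * (2 + b) < (a + 2) * (2 + b) * (2 + c)
σ₁-decreases a b c = <-of-excess (3 + 4 * c + 2 * b + 2 * b * c) (excess a b c)
  where
  excess : ∀ a b c → (a + 2) * (2 + b) * (2 + c)
                   ≡ suc ((a * (2 + c) + 2) * (2 + b) + (3 + 4 * c + 2 * b + 2 * b * c))
  excess = solve-∀

σ₃-decreases : ∀ a w b → ((2 + w) * a + 2) * (2 + b) < (2 + w) * ((a + 2) * (2 + b))
σ₃-decreases a w b = <-of-excess (3 + 2 * b + 4 * w + 2 * b * w) (excess a w b)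
  where
  excess : ∀ a w b → (2 + w) * ((a + 2) * (2 + b))
                   ≡ suc (((2 + w) * a + 2) * (2 + b) + (3 + 2 * b + 4 * w + 2 * b * w))
  excess = solve-∀

-- σ-steps strictly decrease Φ; since multiplication by a factor ≥ 2 is
-- strictly monotone, this propagates through balanced contexts.
Φ-decreases : ∀ {t t'} → t ⟶[ σ ] t' → Φ t' < Φ t
Φ-decreases {app (app (lam t) u) s} rule-σ₁ rewrite Φ-shift 0 s with Φ-≥2 u | Φ-≥2 s
... | b , eb | c , ec rewrite eb | ec = σ₁-decreases (Φ t) b c
Φ-decreases {app v (app (lam s) u)} (rule-σ₃ _) rewrite Φ-shift 0 v with Φ-≥2 v | Φ-≥2 u
... | w , ew | b , eb rewrite ew | eb = σ₃-decreases (Φ s) w b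
Φ-decreases {app t u} (ctx-appR p) with Φ-≥2 t
... | a , ea rewrite ea = *-monoʳ-< (2 + a) (Φ-decreases p)
Φ-decreases {app t u} (ctx-appL p) with Φ-≥2 u
... | a , ea rewrite ea = *-monoˡ-< (2 + a) (Φ-decreases p)
Φ-decreases {app (lam t) u} (ctx-lam p) with Φ-≥2 u
... | a , ea rewrite ea = *-monoˡ-< (2 + a) (+-monoˡ-< 2 (Φ-decreases p))

data _⊏_ : Rel (ℕ × Term) 0ℓ where
  fewer-βv  : ∀ {m n s t} → m < n → (m , s) ⊏ (n , t)
  smaller-Φ : ∀ {n s t} → Φ s < Φ t → (n , s) ⊏ (n , t)

⊏-wellFounded : WellFounded _⊏_
⊏-wellFounded = Subrelation.wellFounded ⊏⇒lex
  (×-wellFounded <-wellFounded (On.wellFounded Φ <-wellFounded))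
  where
  ⊏⇒lex : ∀ {x y} → x ⊏ y → ×-Lex _≡_ _<_ (_<_ on Φ) x y
  ⊏⇒lex (fewer-βv m<n)  = inj₁ m<n
  ⊏⇒lex (smaller-Φ s<t) = inj₂ (refl , s<t)

⊏-trans : Transitive _⊏_
⊏-trans (fewer-βv  a<b) (fewer-βv  b<c) = fewer-βv (<-trans a<b b<c)
⊏-trans (fewer-βv  a<b) (smaller-Φ _)   = fewer-βv a<b
⊏-trans (smaller-Φ _)   (fewer-βv  b<c) = fewer-βv b<c
⊏-trans (smaller-Φ a<b) (smaller-Φ b<c) = smaller-Φ (<-trans a<b b<c)

step-⊏ : ∀ {t k s m} → t ⟶[ k ] s → (m , s) ⊏ (βcount k + m , t)
step-⊏ {k = βv} p = fewer-βv (n<1+n _)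
step-⊏ {k = σ}  p = smaller-Φ (Φ-decreases p)

_⇓_ : Term → ℕ → Set
t ⇓ n = ∃ λ u → t ⟶*[ n ] u × Normal u

⇓-prepend : ∀ {t q c m} → t ⟶*[ c ] q → q ⇓ m → t ⇓ (c + m)
⇓-prepend d (u , e , nu) = u , d ++ e , nu

Preserved : ℕ × Term → Set
Preserved (n , t) = t ⇓ n → ∀ {k s} → t ⟶[ k ] s → ∃ λ m → s ⇓ m × n ≡ βcount k + m

-- Under the induction hypothesis at x, preservation extends to derivations
-- starting from any point below x: every step of the derivation descends.
preserved-along : ∀ {x n t c q} → WfRec _⊏_ Preserved x → (n , t) ⊏ x →
  t ⇓ n → t ⟶*[ c ] q → ∃ λ m → q ⇓ m × n ≡ c + m
preserved-along ih below t⇓n done = _ , t⇓n , refl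
preserved-along ih below t⇓n (step {k = k} {n = c} p d) with ih below t⇓n p
... | m , s⇓m , refl with preserved-along ih (⊏-trans (step-⊏ p) below) s⇓m d
... | m' , q⇓m' , m≡c+m' =
  m' , q⇓m' , trans (cong (βcount k +_) m≡c+m') (sym (+-assoc (βcount k) c m'))

-- Given t ⟶[ k' ] t' ⟶* u (normal) and t ⟶[ k ] s,
-- join s and t' at q; the derivation t' ⟶* q starts below (n , t), so q
-- normalizes with the βv-steps that remain, and s reaches q first.
preservation-step : ∀ x → WfRec _⊏_ Preserved x → Preserved x
preservation-step _ ih (u , done , nu) st = ⊥-elim (nu (_ , _ , st))
preservation-step _ ih (u , step {k = k'} {n = n'} p d , nu) {k} st
  with local-confluence st p
... | q , c₁ , c₂ , s⇒q , t'⇒q , balance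
  with preserved-along ih (step-⊏ p) (u , d , nu) t'⇒q
... | m , q⇓m , n'≡c₂+m = c₁ + m , ⇓-prepend s⇒q q⇓m , count
  where
  open ≡-Reasoning
  count : βcount k' + n' ≡ βcount k + (c₁ + m)
  count = begin
    βcount k' + n'         ≡⟨ cong (βcount k' +_) n'≡c₂+m ⟩
    βcount k' + (c₂ + m)   ≡⟨ sym (+-assoc (βcount k') c₂ m) ⟩
    (βcount k' + c₂) + m   ≡⟨ cong (_+ m) (sym balance) ⟩
    (βcount k + c₁) + m    ≡⟨ +-assoc (βcount k) c₁ m ⟩
    βcount k + (c₁ + m)    ∎

preservation : ∀ x → Preserved x
preservation = All.wfRec ⊏-wellFounded 0ℓ Preserved preservation-step

⇓-unique : ∀ {t u n₁ n₂} → t ⟶*[ n₁ ] u → Normal u → t ⇓ n₂ → n₁ ≡ n₂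
⇓-unique done nu (_ , done , _)       = refl
⇓-unique done nu (_ , step p _ , _)   = ⊥-elim (nu (_ , _ , p))
⇓-unique (step {k = k} p d) nu t⇓n₂ with preservation _ t⇓n₂ p
... | m , s⇓m , refl = cong (βcount k +_) (⇓-unique d nu s⇓m)

corollary3 : ∀ (t u₁ u₂ : Term) (n₁ n₂ : ℕ) →
    t ⟶*[ n₁ ] u₁ → Normal u₁ →
    t ⟶*[ n₂ ] u₂ → Normal u₂ →
    n₁ ≡ n₂
corollary3 t u₁ u₂ n₁ n₂ d₁ nu₁ d₂ nu₂ = ⇓-unique d₁ nu₁ (u₂ , d₂ , nu₂)
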